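{- Let $n\in\mathbb{Z}^+$ be even with $n\geq 4$. The Möbius ladder $M_n$ is a cubic 3-balanced graph if and only if $6\mid n$.
   Context: For even $n\geq 4$, the Möbius ladder $M_n$ is the graph obtained from an $n$-cycle $v_1v_2\cdots v_nv_1$ by adding the edges $v_iv_{i+n/2}$ joining opposite vertices. A graph is 3-balanced if it admits a vertex coloring $\ell:V\to\mathbb{Z}_3$ such that every vertex has, in its open neighborhood, the same number of vertices of each of the three colors. -}

module Defs where

open import Data.Nat using (ℕ; _+_; _∸_; _<ᵇ_; _/_)
open import Data.Bool using (Bool; if_then_else_)
open import Data.Fin using (Fin; toℕ)
open import Data.List using (List; length; filter)
open import Data.List using () renaming (allFin to allFinL)
open import Data.Product using (Σ; _×_; ∃)
open import Data.Sum using (_⊎_)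
open import Relation.Binary using (Rel; Decidable)
open import Relation.Binary.PropositionalEquality using (_≡_)
open import Relation.Nullary using (Dec)
open import Relation.Nullary.Decidable using (_⊎-dec_; _×-dec_)
open import Data.Nat.Properties using (_≟_)
open import Data.Fin.Properties using () renaming (_≟_ to _≟F_)
open import Level using (0ℓ)

record Graph (n : ℕ) : Set₁ where
  field
    Adj  : Rel (Fin n) 0ℓ
    adj? : Decidable Adj
open Graph public

N : ∀ {n} (G : Graph n) → Fin n → List (Fin n)
N {n} G v = filter (adj? G v) (allFinL n)

degree : ∀ {n} (G : Graph n) → Fin n → ℕ
degree G v = length (N G v)

IsCubic : ∀ {n} → Graph n → Set
IsCubic {n} G = (v : Fin n) → degree G v ≡ 3

colourCount : ∀ {n} (G : Graph n) (ℓ : Fin n → Fin 3) → Fin n → Fin 3 → ℕ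
colourCount G ℓ v c = length (filter (λ u → ℓ u ≟F c) (N G v))

Is3Balanced : ∀ {n} → Graph n → Set
Is3Balanced {n} G =
  Σ (Fin n → Fin 3) λ ℓ →
    (v : Fin n) (c c′ : Fin 3) → colourCount G ℓ v c ≡ colourCount G ℓ v c′

-- addition modulo n for arguments a, b < n
addMod : ℕ → ℕ → ℕ → ℕ
addMod n a b = if a + b <ᵇ n then a + b else a + b ∸ n

-- Möbius ladder M_n: vertex i (0-indexed) stands for v_{i+1};
-- i ~ j iff j = i+1, i = j+1 (mod n) (cycle edges) or j = i + n/2 (mod n) (rungs).
MobiusAdj : (n : ℕ) → Rel (Fin n) 0ℓ
MobiusAdj n i j =
  toℕ j ≡ addMod n (toℕ i) 1 ⊎ (toℕ i ≡ addMod n (toℕ j) 1 ⊎ toℕ j ≡ addMod n (toℕ i) (n / 2))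

mobiusAdj? : (n : ℕ) → Decidable (MobiusAdj n)
mobiusAdj? n i j =
  (toℕ j ≟ addMod n (toℕ i) 1) ⊎-dec ((toℕ i ≟ addMod n (toℕ j) 1) ⊎-dec (toℕ j ≟ addMod n (toℕ i) (n / 2)))

Mobius : (n : ℕ) → Graph n
Mobius n = record { Adj = MobiusAdj n ; adj? = mobiusAdj? n }

{-# OPTIONS --safe #-}
-- In M_{2m} the neighbours of v_{k+1} are v_{k+2}, v_k and v_{k+1+m}. A colouring of a cubic
-- graph is 3-balanced exactly when every vertex sees three distinct colours, so writing X k for
-- the colour of v_k, every triple X (k+2), X k, X (k+1+m) is a rainbow. Comparing the rainbows
-- at k and at k+1+m forces X (k+3+m) = X k, hence X (k+4) ≠ X k and X (k+6) = X k. Since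
-- X (2m) = X 0 while X 0, X 2, X 4 are distinct, 3 divides m. Conversely, if 3 divides m then
-- colouring v_k by k mod 3 makes every triple a rainbow.
module Submission where

open import Data.Bool using (true; false; T)
open import Data.Fin using (Fin; toℕ)
open import Data.Fin.Properties using (all?; _≟_; toℕ-fromℕ<; toℕ-injective; toℕ<n)
open import Data.List using (List; []; _∷_; length; filter; map; allFin)
open import Data.List.Membership.Propositional using (_∈_)
open import Data.List.Membership.Propositional.Properties
  using (∈-filter⁺; ∈-filter⁻; ∈-allFin)
open import Data.List.Membership.Propositional.Properties.WithK using (unique∧set⇒bag)
open import Data.List.Relation.Binary.BagAndSetEquality using (∼bag⇒↭)
open import Data.List.Relation.Binary.Permutation.Propositional using (_↭_)
open import Data.List.Relation.Binary.Permutation.Propositional.Properties using (↭-length; filter-↭)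
open import Data.List.Relation.Unary.All using ([]; _∷_)
open import Data.List.Relation.Unary.AllPairs using ([]; _∷_)
open import Data.List.Relation.Unary.Any using (here; there)
open import Data.List.Relation.Unary.Unique.Propositional using (Unique)
open import Data.List.Relation.Unary.Unique.Propositional.Properties using (allFin⁺; filter⁺)
open import Data.Nat
  using (ℕ; zero; suc; pred; _+_; _*_; _∸_; _<_; _≤_; _<ᵇ_; _%_; _/_; NonZero; s≤s; z<s; s<s)
open import Data.Nat.DivMod
open import Data.Nat.Divisibility
  using (_∣_; divides; _∣0; ∣-refl; ∣-trans; m∣m*n; ∣m∣n⇒∣m+n; *-monoˡ-∣; *-cancelʳ-∣)
open import Data.Nat.Properties
  using ( <ᵇ⇒<; <⇒<ᵇ; ≮⇒≥; <⇒≢; +-mono-<; m<n+o⇒m∸n<o; +-assoc; +-comm; +-suc; *-suc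
        ; <-trans; n<1+n; m≤m*n)
  renaming (_≟_ to _≟ℕ_)
open import Data.Nat.Tactic.RingSolver using (solve-∀)
open import Data.Product using (_×_; _,_; proj₁; proj₂; ∃-syntax)
open import Data.Sum using (_⊎_; inj₁; inj₂)
open import Data.Sum.Function.Propositional using (_⊎-cong_)
open import Data.Unit using (tt)
open import Function using (_∘_; _⇔_; mk⇔; Equivalence)
open import Function.Construct.Composition using (_⇔-∘_)
open import Level using (0ℓ)
open import Relation.Binary.PropositionalEquality
open import Relation.Nullary using (Dec; ¬?; does; contradiction)
open import Relation.Nullary.Decidable using (from-yes; _×-dec_; _→-dec_)
open import Relation.Unary using (Pred; Decidable)

open import Defs

count : Fin 3 → List (Fin 3) → ℕ
count c = length ∘ filter (_≟ c)

Balanced : List (Fin 3) → Set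
Balanced cs = ∀ c c′ → count c cs ≡ count c′ cs

Rainbow : Fin 3 → Fin 3 → Fin 3 → Set
Rainbow x y z = x ≢ y × x ≢ z × y ≢ z

balanced? : ∀ cs → Dec (Balanced cs)
balanced? cs = all? λ c → all? λ c′ → count c cs ≟ℕ count c′ cs

rainbow? : ∀ x y z → Dec (Rainbow x y z)
rainbow? x y z = ¬? (x ≟ y) ×-dec ¬? (x ≟ z) ×-dec ¬? (y ≟ z)

balanced⇒rainbow : ∀ x y z → Balanced (x ∷ y ∷ z ∷ []) → Rainbow x y z
balanced⇒rainbow = from-yes (all? λ x → all? λ y → all? λ z →
  balanced? (x ∷ y ∷ z ∷ []) →-dec rainbow? x y z)

rainbow⇒balanced : ∀ x y z → Rainbow x y z → Balanced (x ∷ y ∷ z ∷ [])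
rainbow⇒balanced = from-yes (all? λ x → all? λ y → all? λ z →
  rainbow? x y z →-dec balanced? (x ∷ y ∷ z ∷ []))

third-unique : ∀ {x y z w : Fin 3} →
  x ≢ y → z ≢ x → z ≢ y → w ≢ x → w ≢ y → z ≡ w
third-unique {x} {y} {z} {w} = check x y z w
  where
  check : ∀ x y z w → x ≢ y → z ≢ x → z ≢ y → w ≢ x → w ≢ y → z ≡ w
  check = from-yes (all? λ (x : Fin 3) → all? λ y → all? λ z → all? λ w →
    ¬? (x ≟ y) →-dec ¬? (z ≟ x) →-dec ¬? (z ≟ y) →-dec
    ¬? (w ≟ x) →-dec ¬? (w ≟ y) →-dec z ≟ w)

length-filter-map : ∀ {A B : Set} {P : Pred B 0ℓ} (P? : Decidable P) (f : A → B) xs →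
  length (filter (P? ∘ f) xs) ≡ length (filter P? (map f xs))
length-filter-map P? f [] = refl
length-filter-map P? f (x ∷ xs) with does (P? (f x))
... | true  = cong suc (length-filter-map P? f xs)
... | false = length-filter-map P? f xs

∈-triple⇔ : ∀ {A : Set} {u a b c : A} → (u ≡ a ⊎ (u ≡ b ⊎ u ≡ c)) ⇔ u ∈ a ∷ b ∷ c ∷ []
∈-triple⇔ = mk⇔
  (λ { (inj₁ e)        → here e
     ; (inj₂ (inj₁ e)) → there (here e)
     ; (inj₂ (inj₂ e)) → there (there (here e)) })
  (λ { (here e)                 → inj₁ e
     ; (there (here e))         → inj₂ (inj₁ e)
     ; (there (there (here e))) → inj₂ (inj₂ e) })

module _ {n} (G : Graph n) where

  BalancedAt : (Fin n → Fin 3) → Fin n → Set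
  BalancedAt ℓ v = ∀ c c′ → colourCount G ℓ v c ≡ colourCount G ℓ v c′

  N-↭ : ∀ {v xs} → Unique xs → (∀ {u} → Adj G v u ⇔ u ∈ xs) → N G v ↭ xs
  N-↭ {v} xs! adj⇔∈ = ∼bag⇒↭ (unique∧set⇒bag (filter⁺ (adj? G v) (allFin⁺ n)) xs! (mk⇔
    (λ u∈N → Equivalence.to adj⇔∈ (proj₂ (∈-filter⁻ (adj? G v) {xs = allFin n} u∈N)))
    (λ u∈xs → ∈-filter⁺ (adj? G v) (∈-allFin _) (Equivalence.from adj⇔∈ u∈xs))))

  colourCount-↭ : ∀ ℓ {v xs} → N G v ↭ xs → ∀ c → colourCount G ℓ v c ≡ count c (map ℓ xs)
  colourCount-↭ ℓ {xs = xs} N↭xs c =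
    trans (↭-length (filter-↭ (λ u → ℓ u ≟ c) N↭xs)) (length-filter-map (_≟ c) ℓ xs)

  balancedAt⇔rainbow : ∀ ℓ v {x y z} → N G v ↭ x ∷ y ∷ z ∷ [] →
    BalancedAt ℓ v ⇔ Rainbow (ℓ x) (ℓ y) (ℓ z)
  balancedAt⇔rainbow ℓ v {x} {y} {z} N↭xyz = mk⇔
    (λ balanced → balanced⇒rainbow (ℓ x) (ℓ y) (ℓ z) λ c c′ →
      trans (sym (count≡ c)) (trans (balanced c c′) (count≡ c′)))
    (λ rainbow c c′ → trans (count≡ c)
      (trans (rainbow⇒balanced (ℓ x) (ℓ y) (ℓ z) rainbow c c′) (sym (count≡ c′))))
    where
    count≡ : ∀ c → colourCount G ℓ v c ≡ count c (ℓ x ∷ ℓ y ∷ ℓ z ∷ [])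
    count≡ = colourCount-↭ ℓ N↭xyz

toℕ-mod : ∀ a n .{{_ : NonZero n}} → toℕ (a mod n) ≡ a % n
toℕ-mod a n = toℕ-fromℕ< (m%n<n a n)

mod≡⇒%≡ : ∀ a b n .{{_ : NonZero n}} → a mod n ≡ b mod n → a % n ≡ b % n
mod≡⇒%≡ a b n e = trans (sym (toℕ-mod a n)) (trans (cong toℕ e) (toℕ-mod b n))

%≡⇒mod≡ : ∀ a b n .{{_ : NonZero n}} → a % n ≡ b % n → a mod n ≡ b mod n
%≡⇒mod≡ a b n e = toℕ-injective (trans (toℕ-mod a n) (trans e (sym (toℕ-mod b n))))

%-+-congʳ : ∀ a b c n .{{_ : NonZero n}} → a % n ≡ b % n → (a + c) % n ≡ (b + c) % n
%-+-congʳ a b c n e = begin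
  (a + c) % n          ≡⟨ %-distribˡ-+ a c n ⟩
  (a % n + c % n) % n  ≡⟨ cong (λ r → (r + c % n) % n) e ⟩
  (b % n + c % n) % n  ≡⟨ %-distribˡ-+ b c n ⟨
  (b + c) % n          ∎
  where open ≡-Reasoning

%-+-cancelʳ : ∀ a b c n .{{_ : NonZero n}} → (a + c) % n ≡ (b + c) % n → a % n ≡ b % n
%-+-cancelʳ a b c n@(suc n-1) e = begin
  a % n                  ≡⟨ [m+kn]%n≡m%n a c n ⟨
  (a + c * n) % n        ≡⟨ cong (_% n) (split a) ⟩
  (a + c + c * n-1) % n  ≡⟨ %-+-congʳ (a + c) (b + c) (c * n-1) n e ⟩
  (b + c + c * n-1) % n  ≡⟨ cong (_% n) (split b) ⟨
  (b + c * n) % n        ≡⟨ [m+kn]%n≡m%n b c n ⟩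
  b % n                  ∎
  where
  open ≡-Reasoning
  split : ∀ x → x + c * n ≡ x + c + c * n-1
  split x = trans (cong (x +_) (*-suc c n-1)) (sym (+-assoc x c (c * n-1)))

mod-shift-≢ : ∀ d a n .{{_ : NonZero n}} → 0 < d → d < n → (d + a) mod n ≢ a mod n
mod-shift-≢ d a n@(suc _) 0<d d<n e =
  <⇒≢ 0<d (sym (trans (sym (m<n⇒m%n≡m d<n))
    (%-+-cancelʳ d 0 a n (mod≡⇒%≡ (d + a) a n e))))

addMod≡% : ∀ {a b} n .{{_ : NonZero n}} → a < n → b < n → addMod n a b ≡ (a + b) % n
addMod≡% {a} {b} n a<n b<n with a + b <ᵇ n in eq
... | true  = sym (m<n⇒m%n≡m (<ᵇ⇒< (a + b) n (subst T (sym eq) tt)))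
... | false = begin
  a + b ∸ n        ≡⟨ m<n⇒m%n≡m (m<n+o⇒m∸n<o (a + b) n (+-mono-< a<n b<n)) ⟨
  (a + b ∸ n) % n  ≡⟨ m≤n⇒[n∸m]%m≡n%m (≮⇒≥ λ a+b<n → subst T eq (<⇒<ᵇ a+b<n)) ⟩
  (a + b) % n      ∎
  where open ≡-Reasoning

-- X k stands for the colour of the vertex v_k of M_{2m} (indices taken mod 2m); the three
-- colours are those of the neighbours of v_{k+1}.
LadderRainbow : ℕ → (ℕ → Fin 3) → Set
LadderRainbow m X = ∀ k → Rainbow (X (2 + k)) (X k) (X (suc k + m))

LadderRainbow-resp : ∀ {m X Y} →
  (∀ k → X k ≡ Y k) → LadderRainbow m X → LadderRainbow m Y
LadderRainbow-resp {m} X≗Y rainbow k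
  rewrite sym (X≗Y (2 + k)) | sym (X≗Y k) | sym (X≗Y (suc k + m)) = rainbow k

mod3-ladderRainbow : ∀ {m} → 3 ∣ m → LadderRainbow m (_mod 3)
mod3-ladderRainbow {m} 3∣m k =
    mod-shift-≢ 2 k 3 z<s (s<s (s<s z<s))
  , (λ e → mod-shift-≢ 1 (suc k) 3 z<s (s<s z<s) (trans e rung))
  , (λ e → mod-shift-≢ 1 k 3 z<s (s<s z<s) (sym (trans e rung)))
  where
  rung : (suc k + m) mod 3 ≡ suc k mod 3
  rung = %≡⇒mod≡ (suc k + m) (suc k) 3 (%-remove-+ʳ (suc k) 3∣m)

module _ {m} {X : ℕ → Fin 3}
         (periodic : ∀ k → X (k + m * 2) ≡ X k) (rainbow : LadderRainbow m X) where

  private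
    r₁ : ∀ k → X (2 + k) ≢ X k
    r₁ = proj₁ ∘ rainbow
    r₂ : ∀ k → X (2 + k) ≢ X (suc k + m)
    r₂ = proj₁ ∘ proj₂ ∘ rainbow
    r₃ : ∀ k → X k ≢ X (suc k + m)
    r₃ = proj₂ ∘ proj₂ ∘ rainbow

  X[3+k+m]≡X[k] : ∀ k → X (3 + k + m) ≡ X k
  X[3+k+m]≡X[k] k = third-unique
    (r₂ k) (λ e → r₂ j (trans e (sym X[1+j+m]≡X[2+k]))) (r₁ j) (r₁ k ∘ sym) (r₃ k)
    where
    j : ℕ
    j = suc k + m
    index : ∀ k m → suc (suc k + m) + m ≡ 2 + k + m * 2
    index = solve-∀
    X[1+j+m]≡X[2+k] : X (suc j + m) ≡ X (2 + k)
    X[1+j+m]≡X[2+k] = trans (cong X (index k m)) (periodic (2 + k))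

  X[4+k]≢X[k] : ∀ k → X (4 + k) ≢ X k
  X[4+k]≢X[k] k e = r₂ (2 + k) (trans e (sym (X[3+k+m]≡X[k] k)))

  X[6+k]≡X[k] : ∀ k → X (6 + k) ≡ X k
  X[6+k]≡X[k] k = third-unique
    (r₁ (2 + k) ∘ sym) (X[4+k]≢X[k] (2 + k)) (r₁ (4 + k)) (r₁ k ∘ sym) (X[4+k]≢X[k] k ∘ sym)

  X[2j]≡X[0]⇒3∣j : ∀ j → X (j * 2) ≡ X 0 → 3 ∣ j
  X[2j]≡X[0]⇒3∣j 0 _ = 3 ∣0
  X[2j]≡X[0]⇒3∣j 1 e = contradiction e (r₁ 0)
  X[2j]≡X[0]⇒3∣j 2 e = contradiction e (X[4+k]≢X[k] 0)
  X[2j]≡X[0]⇒3∣j (suc (suc (suc j))) e =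
    ∣m∣n⇒∣m+n ∣-refl (X[2j]≡X[0]⇒3∣j j (trans (sym (X[6+k]≡X[k] (j * 2))) e))

  ladderRainbow⇒3∣m : 3 ∣ m
  ladderRainbow⇒3∣m = X[2j]≡X[0]⇒3∣j m (periodic 0)

module MobiusLadder (p : ℕ) where

  m n : ℕ
  m = 2 + p
  n = m * 2

  V : ℕ → Fin n
  V k = k mod n

  1+m<n : suc m < n
  1+m<n = s≤s (s≤s (s≤s (s≤s (m≤m*n p 2))))

  m<n : m < n
  m<n = <-trans (n<1+n m) 1+m<n

  V-toℕ : ∀ v → V (toℕ v) ≡ v
  V-toℕ v = toℕ-injective (trans (toℕ-mod (toℕ v) n) (m<n⇒m%n≡m (toℕ<n v)))

  V-periodic : ∀ k → V (k + n) ≡ V k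
  V-periodic k = %≡⇒mod≡ (k + n) k n ([m+n]%n≡m%n k n)

  V-suc-surjective : ∀ v → ∃[ k ] V (suc k) ≡ v
  V-suc-surjective v = toℕ v + pred n ,
    trans (cong V (sym (+-suc (toℕ v) (pred n)))) (trans (V-periodic (toℕ v)) (V-toℕ v))

  addMod-V : ∀ a b → b < n → addMod n (toℕ (V a)) b ≡ (a + b) % n
  addMod-V a b b<n = begin
    addMod n (toℕ (V a)) b  ≡⟨ addMod≡% n (toℕ<n (V a)) b<n ⟩
    (toℕ (V a) + b) % n     ≡⟨ %-+-congʳ (toℕ (V a)) a b n V[a]%n≡a%n ⟩
    (a + b) % n             ∎
    where
    open ≡-Reasoning
    V[a]%n≡a%n : toℕ (V a) % n ≡ a % n
    V[a]%n≡a%n = trans (cong (_% n) (toℕ-mod a n)) (m%n%n≡m%n a n)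

  toℕ≡⇔≡V : ∀ {u r} k → r ≡ k % n → (toℕ u ≡ r) ⇔ (u ≡ V k)
  toℕ≡⇔≡V k r≡ = mk⇔
    (λ e → toℕ-injective (trans e (trans r≡ (sym (toℕ-mod k n)))))
    (λ { refl → trans (toℕ-mod k n) (sym r≡) })

  module _ (k : ℕ) {u : Fin n} where

    next⇔ : (toℕ u ≡ addMod n (toℕ (V (suc k))) 1) ⇔ (u ≡ V (2 + k))
    next⇔ = toℕ≡⇔≡V (2 + k)
      (trans (addMod-V (suc k) 1 (s<s z<s)) (cong (_% n) (+-comm (suc k) 1)))

    prev⇔ : (toℕ (V (suc k)) ≡ addMod n (toℕ u) 1) ⇔ (u ≡ V k)
    prev⇔ = toℕ≡⇔≡V k refl ⇔-∘ mk⇔ to from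
      where
      lhs : toℕ (V (suc k)) ≡ (k + 1) % n
      lhs = trans (toℕ-mod (suc k) n) (cong (_% n) (+-comm 1 k))
      rhs : addMod n (toℕ u) 1 ≡ (toℕ u + 1) % n
      rhs = addMod≡% n (toℕ<n u) (s<s z<s)
      to : toℕ (V (suc k)) ≡ addMod n (toℕ u) 1 → toℕ u ≡ k % n
      to e = trans (sym (m<n⇒m%n≡m (toℕ<n u)))
        (sym (%-+-cancelʳ k (toℕ u) 1 n (trans (sym lhs) (trans e rhs))))
      from : toℕ u ≡ k % n → toℕ (V (suc k)) ≡ addMod n (toℕ u) 1
      from e = trans lhs (trans (%-+-congʳ k (toℕ u) 1 n k%n≡u%n) (sym rhs))
        where
        k%n≡u%n : k % n ≡ toℕ u % n
        k%n≡u%n = sym (trans (cong (_% n) e) (m%n%n≡m%n k n))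

    rung⇔ : (toℕ u ≡ addMod n (toℕ (V (suc k))) (n / 2)) ⇔ (u ≡ V (suc k + m))
    rung⇔ = toℕ≡⇔≡V (suc k + m)
      (trans (cong (addMod n (toℕ (V (suc k)))) (m*n/n≡m m 2)) (addMod-V (suc k) m m<n))

  neighbours : ∀ k → N (Mobius n) (V (suc k)) ↭ V (2 + k) ∷ V k ∷ V (suc k + m) ∷ []
  neighbours k = N-↭ (Mobius n) ((ab ∷ ac ∷ []) ∷ (bc ∷ []) ∷ [] ∷ [])
    (∈-triple⇔ ⇔-∘ (next⇔ k ⊎-cong (prev⇔ k ⊎-cong rung⇔ k)))
    where
    ab : V (2 + k) ≢ V k
    ab = mod-shift-≢ 2 k n z<s (s<s (s<s z<s))
    ac : V (2 + k) ≢ V (suc k + m)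
    ac e = mod-shift-≢ (suc p) (2 + k) n z<s (<-trans (n<1+n (suc p)) m<n)
      (trans (cong V (index k p)) (sym e))
      where
      index : ∀ k p → suc p + (2 + k) ≡ suc k + (2 + p)
      index = solve-∀
    bc : V k ≢ V (suc k + m)
    bc e = mod-shift-≢ (suc m) k n z<s 1+m<n (trans (cong V (cong suc (+-comm m k))) (sym e))

  cubic : IsCubic (Mobius n)
  cubic v with V-suc-surjective v
  ... | k , refl = ↭-length (neighbours k)

  3-balanced⇔ladderRainbow : Is3Balanced (Mobius n) ⇔ (∃[ ℓ ] LadderRainbow m (ℓ ∘ V))
  3-balanced⇔ladderRainbow = mk⇔
    (λ (ℓ , balanced) → ℓ , λ k → Equivalence.to (at ℓ k) (balanced (V (suc k))))
    (λ (ℓ , rainbow) → ℓ , balancedAt-everywhere ℓ rainbow)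
    where
    at : ∀ ℓ k → BalancedAt (Mobius n) ℓ (V (suc k))
                   ⇔ Rainbow (ℓ (V (2 + k))) (ℓ (V k)) (ℓ (V (suc k + m)))
    at ℓ k = balancedAt⇔rainbow (Mobius n) ℓ (V (suc k)) (neighbours k)
    balancedAt-everywhere : ∀ ℓ → LadderRainbow m (ℓ ∘ V) → ∀ v → BalancedAt (Mobius n) ℓ v
    balancedAt-everywhere ℓ rainbow v with V-suc-surjective v
    ... | k , refl = Equivalence.from (at ℓ k) (rainbow k)

  residue : Fin n → Fin 3
  residue v = toℕ v mod 3

  residue-ladderRainbow : 3 ∣ m → LadderRainbow m (residue ∘ V)
  residue-ladderRainbow 3∣m = LadderRainbow-resp colour≡ (mod3-ladderRainbow 3∣m)
    where
    colour≡ : ∀ k → k mod 3 ≡ residue (V k)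
    colour≡ k = %≡⇒mod≡ k (toℕ (V k)) 3
      (sym (trans (cong (_% 3) (toℕ-mod k n)) (m∣n⇒o%n%m≡o%m 3 n k (∣-trans 3∣m (m∣m*n 2)))))

theorem6p1 : (n : ℕ) → 2 ∣ n → 4 ≤ n →
    (IsCubic (Mobius n) × Is3Balanced (Mobius n)) ⇔ (6 ∣ n)
theorem6p1 .(0 * 2) (divides zero refl) ()
theorem6p1 .(1 * 2) (divides (suc zero) refl) (s≤s (s≤s ()))
theorem6p1 .(suc (suc p) * 2) (divides (suc (suc p)) refl) _ = mk⇔
  (λ (_ , balanced) → let (ℓ , rainbow) = Equivalence.to 3-balanced⇔ladderRainbow balanced in
    *-monoˡ-∣ 2 (ladderRainbow⇒3∣m (cong ℓ ∘ V-periodic) rainbow))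
  (λ 6∣n → cubic ,
    Equivalence.from 3-balanced⇔ladderRainbow (residue , residue-ladderRainbow (*-cancelʳ-∣ 2 6∣n)))
  where open MobiusLadder p
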